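{- Let $v\ge 2$. Suppose $M$ is the incidence matrix of a symmetric $(v,k,\lambda)$ design and $M=M_1+M_2$, where $M_i$ is the incidence matrix of a symmetric $(v,k_i,\lambda_i)$ design for $i=1,2$. Then $k=k_1+k_2$ and $\lambda=\lambda_1+\lambda_2+\alpha$, where $\alpha=\frac{2k_1k_2}{v-1}$ is an integer. Furthermore $M_1M_2^{\top}+M_2M_1^{\top}=\alpha(J_v-I_v)$.
   Context: A symmetric $(v,k,\lambda)$ design has as incidence matrix a $v\times v$ matrix $M$ with entries in $\{0,1\}$, every row and every column containing exactly $k$ ones, such that $MM^{\top}=M^{\top}M=(k-\lambda)I_v+\lambda J_v$, where $I_v$ is the identity and $J_v$ the all-ones $v\times v$ matrix. -}

module Defs where

open import Data.Nat using (ℕ; zero; suc)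
open import Data.Fin using (Fin; zero; suc)
open import Data.Fin.Properties using (_≟_)
open import Data.Integer using (ℤ; _+_; _*_; _-_; 0ℤ; 1ℤ; +_)
open import Data.Product using (_×_)
open import Data.Sum using (_⊎_)
open import Relation.Binary.PropositionalEquality using (_≡_)
open import Relation.Nullary.Decidable using (does)
open import Data.Bool using (if_then_else_)

Matrix : ℕ → Set
Matrix v = Fin v → Fin v → ℤ

sumFin : ∀ {n} → (Fin n → ℤ) → ℤ
sumFin {zero}  f = 0ℤ
sumFin {suc n} f = f zero + sumFin (λ i → f (suc i))

_ᵀ : ∀ {v} → Matrix v → Matrix v
(M ᵀ) i j = M j i

_·_ : ∀ {v} → Matrix v → Matrix v → Matrix v
(A · B) i j = sumFin (λ l → A i l * B l j)

_⊕_ : ∀ {v} → Matrix v → Matrix v → Matrix v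
(A ⊕ B) i j = A i j + B i j

_⊖_ : ∀ {v} → Matrix v → Matrix v → Matrix v
(A ⊖ B) i j = A i j - B i j

_•_ : ∀ {v} → ℤ → Matrix v → Matrix v
(c • A) i j = c * A i j

I : ∀ v → Matrix v
I v i j = if does (i ≟ j) then 1ℤ else 0ℤ

J : ∀ v → Matrix v
J v i j = 1ℤ

_≋_ : ∀ {v} → Matrix v → Matrix v → Set
A ≋ B = ∀ i j → A i j ≡ B i j

record IsSymmetricDesign (v k λ' : ℕ) (M : Matrix v) : Set where
  field
    zeroOne   : ∀ i j → (M i j ≡ 0ℤ) ⊎ (M i j ≡ 1ℤ)
    rowSums   : ∀ i → sumFin (λ j → M i j) ≡ + k
    colSums   : ∀ j → sumFin (λ i → M i j) ≡ + k
    MMᵀ       : (M · (M ᵀ)) ≋ ((((+ k) - (+ λ')) • I v) ⊕ ((+ λ') • J v))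
    MᵀM       : ((M ᵀ) · M) ≋ ((((+ k) - (+ λ')) • I v) ⊕ ((+ λ') • J v))

-- Row sums give k = k₁ + k₂. Expanding (M₁ + M₂)(M₁ + M₂)ᵀ against the identities
-- MMᵀ = (k − λ)I + λJ of the three designs shows that the cross term
-- N = M₁M₂ᵀ + M₂M₁ᵀ equals α(J − I) with α = λ − λ₁ − λ₂. Summing a row of N in
-- two ways gives α(v − 1) on one side and, since every row of Mᵢ sums to kᵢ and
-- every column of Mⱼ to kⱼ, k₁k₂ + k₂k₁ on the other.
module Submission where

open import Defs
open import Data.Nat using (ℕ; zero; suc; _≥_; _+_; _*_; _∸_; s≤s)
open import Data.Integer using (ℤ; +_; 0ℤ; 1ℤ) renaming (_+_ to _+ℤ_; _*_ to _*ℤ_; _-_ to _-ℤ_)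
import Data.Integer.Properties as ℤP
open import Data.Integer.Solver using (module +-*-Solver)
open import Data.Fin using (Fin; zero; suc)
open import Data.Product using (_×_; ∃-syntax; _,_)
open import Function using (_∘_)
open import Relation.Binary.PropositionalEquality
  using (_≡_; refl; sym; trans; cong; cong₂; _≗_; module ≡-Reasoning)
open import Algebra.Properties.Semiring.Sum ℤP.+-*-semiring
  using (sum; sum-cong-≗; ∑-distrib-+; ∑-comm; *-distribˡ-sum; *-distribʳ-sum)

open +-*-Solver
open ≡-Reasoning

sumFin≡sum : ∀ {n} (f : Fin n → ℤ) → sumFin f ≡ sum f
sumFin≡sum {zero}  f = refl
sumFin≡sum {suc n} f = cong (f zero +ℤ_) (sumFin≡sum (f ∘ suc))

sumFin-cong : ∀ {n} {f g : Fin n → ℤ} → f ≗ g → sumFin f ≡ sumFin g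
sumFin-cong {f = f} {g} f≗g = begin
  sumFin f ≡⟨ sumFin≡sum f ⟩
  sum f    ≡⟨ sum-cong-≗ f≗g ⟩
  sum g    ≡⟨ sumFin≡sum g ⟨
  sumFin g ∎

sumFin-distrib-+ : ∀ {n} (f g : Fin n → ℤ) →
                   sumFin (λ i → f i +ℤ g i) ≡ sumFin f +ℤ sumFin g
sumFin-distrib-+ f g = begin
  sumFin (λ i → f i +ℤ g i) ≡⟨ sumFin≡sum (λ i → f i +ℤ g i) ⟩
  sum (λ i → f i +ℤ g i)    ≡⟨ ∑-distrib-+ f g ⟩
  sum f +ℤ sum g            ≡⟨ cong₂ _+ℤ_ (sumFin≡sum f) (sumFin≡sum g) ⟨
  sumFin f +ℤ sumFin g      ∎

*-distribˡ-sumFin : ∀ {n} x (f : Fin n → ℤ) → x *ℤ sumFin f ≡ sumFin (λ i → x *ℤ f i)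
*-distribˡ-sumFin x f = begin
  x *ℤ sumFin f            ≡⟨ cong (x *ℤ_) (sumFin≡sum f) ⟩
  x *ℤ sum f               ≡⟨ *-distribˡ-sum x f ⟩
  sum (λ i → x *ℤ f i)     ≡⟨ sumFin≡sum (λ i → x *ℤ f i) ⟨
  sumFin (λ i → x *ℤ f i)  ∎

*-distribʳ-sumFin : ∀ {n} x (f : Fin n → ℤ) → sumFin f *ℤ x ≡ sumFin (λ i → f i *ℤ x)
*-distribʳ-sumFin x f = begin
  sumFin f *ℤ x            ≡⟨ cong (_*ℤ x) (sumFin≡sum f) ⟩
  sum f *ℤ x               ≡⟨ *-distribʳ-sum x f ⟩
  sum (λ i → f i *ℤ x)     ≡⟨ sumFin≡sum (λ i → f i *ℤ x) ⟨
  sumFin (λ i → f i *ℤ x)  ∎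

sumFin-comm : ∀ {m n} (f : Fin m → Fin n → ℤ) →
              sumFin (λ i → sumFin (f i)) ≡ sumFin (λ j → sumFin (λ i → f i j))
sumFin-comm f = begin
  sumFin (λ i → sumFin (f i))             ≡⟨ sumFin-cong (λ i → sumFin≡sum (f i)) ⟩
  sumFin (λ i → sum (f i))                ≡⟨ sumFin≡sum (λ i → sum (f i)) ⟩
  sum (λ i → sum (f i))                   ≡⟨ ∑-comm f ⟩
  sum (λ j → sum (λ i → f i j))           ≡⟨ sumFin≡sum (λ j → sum (λ i → f i j)) ⟨
  sumFin (λ j → sum (λ i → f i j))        ≡⟨ sumFin-cong (λ j → sumFin≡sum (λ i → f i j)) ⟨
  sumFin (λ j → sumFin (λ i → f i j))     ∎

sumFin-const : ∀ n c → sumFin {n} (λ _ → c) ≡ + n *ℤ c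
sumFin-const zero    c = refl
sumFin-const (suc n) c = begin
  c +ℤ sumFin {n} (λ _ → c) ≡⟨ cong (c +ℤ_) (sumFin-const n c) ⟩
  c +ℤ + n *ℤ c             ≡⟨ ℤP.suc-* (+ n) c ⟨
  + suc n *ℤ c              ∎

rowSum : ∀ {v} → Matrix v → Fin v → ℤ
rowSum A i = sumFin (A i)

designGram : ∀ v → ℤ → ℤ → Matrix v
designGram v k λ' = ((k -ℤ λ') • I v) ⊕ (λ' • J v)

module _ {v : ℕ} where

  ·-cong : {A A′ B B′ : Matrix v} → A ≋ A′ → B ≋ B′ → (A · B) ≋ (A′ · B′)
  ·-cong A≋A′ B≋B′ i j = sumFin-cong (λ l → cong₂ _*ℤ_ (A≋A′ i l) (B≋B′ l j))

  ·-distribʳ-⊕ : (A B C : Matrix v) → ((A ⊕ B) · C) ≋ ((A · C) ⊕ (B · C))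
  ·-distribʳ-⊕ A B C i j = begin
    sumFin (λ l → (A i l +ℤ B i l) *ℤ C l j)             ≡⟨ sumFin-cong (λ l → ℤP.*-distribʳ-+ (C l j) (A i l) (B i l)) ⟩
    sumFin (λ l → A i l *ℤ C l j +ℤ B i l *ℤ C l j)      ≡⟨ sumFin-distrib-+ (λ l → A i l *ℤ C l j) (λ l → B i l *ℤ C l j) ⟩
    (A · C) i j +ℤ (B · C) i j                           ∎

  ·-distribˡ-⊕ : (A B C : Matrix v) → (A · (B ⊕ C)) ≋ ((A · B) ⊕ (A · C))
  ·-distribˡ-⊕ A B C i j = begin
    sumFin (λ l → A i l *ℤ (B l j +ℤ C l j))             ≡⟨ sumFin-cong (λ l → ℤP.*-distribˡ-+ (A i l) (B l j) (C l j)) ⟩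
    sumFin (λ l → A i l *ℤ B l j +ℤ A i l *ℤ C l j)      ≡⟨ sumFin-distrib-+ (λ l → A i l *ℤ B l j) (λ l → A i l *ℤ C l j) ⟩
    (A · B) i j +ℤ (A · C) i j                           ∎

  ⊕-·-⊕ᵀ : (A B : Matrix v) →
           ((A ⊕ B) · ((A ⊕ B) ᵀ)) ≋ (((A · (A ᵀ)) ⊕ ((A · (B ᵀ)) ⊕ (B · (A ᵀ)))) ⊕ (B · (B ᵀ)))
  ⊕-·-⊕ᵀ A B i j = begin
    ((A ⊕ B) · (Aᵀ ⊕ Bᵀ)) i j                    ≡⟨ ·-distribʳ-⊕ A B (Aᵀ ⊕ Bᵀ) i j ⟩
    (A · (Aᵀ ⊕ Bᵀ)) i j +ℤ (B · (Aᵀ ⊕ Bᵀ)) i j   ≡⟨ cong₂ _+ℤ_ (·-distribˡ-⊕ A Aᵀ Bᵀ i j) (·-distribˡ-⊕ B Aᵀ Bᵀ i j) ⟩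
    (AAᵀ +ℤ ABᵀ) +ℤ (BAᵀ +ℤ BBᵀ)                  ≡⟨ solve 4 (λ a b c d → (a :+ b) :+ (c :+ d) := (a :+ (b :+ c)) :+ d)
                                                            refl AAᵀ ABᵀ BAᵀ BBᵀ ⟩
    (AAᵀ +ℤ (ABᵀ +ℤ BAᵀ)) +ℤ BBᵀ                  ∎
    where
    Aᵀ = A ᵀ
    Bᵀ = B ᵀ
    AAᵀ = (A · Aᵀ) i j
    ABᵀ = (A · Bᵀ) i j
    BAᵀ = (B · Aᵀ) i j
    BBᵀ = (B · Bᵀ) i j

  rowSum-·ᵀ : (X Y : Matrix v) {a b : ℤ} (i : Fin v) →
              rowSum X i ≡ a → (∀ l → rowSum (Y ᵀ) l ≡ b) → rowSum (X · (Y ᵀ)) i ≡ a *ℤ b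
  rowSum-·ᵀ X Y {a} {b} i rowX colsY = begin
    sumFin (λ j → sumFin (λ l → X i l *ℤ Y j l))   ≡⟨ sumFin-comm (λ j l → X i l *ℤ Y j l) ⟩
    sumFin (λ l → sumFin (λ j → X i l *ℤ Y j l))   ≡⟨ sumFin-cong (λ l → *-distribˡ-sumFin (X i l) (λ j → Y j l)) ⟨
    sumFin (λ l → X i l *ℤ rowSum (Y ᵀ) l)         ≡⟨ sumFin-cong (λ l → cong (X i l *ℤ_) (colsY l)) ⟩
    sumFin (λ l → X i l *ℤ b)                      ≡⟨ *-distribʳ-sumFin b (X i) ⟨
    rowSum X i *ℤ b                                ≡⟨ cong (_*ℤ b) rowX ⟩
    a *ℤ b                                         ∎

  cross-term-≋ : {A A₁ A₂ N : Matrix v} {k k₁ k₂ λ' λ₁ λ₂ : ℤ} → k ≡ k₁ +ℤ k₂ →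
                 A ≋ ((A₁ ⊕ N) ⊕ A₂) →
                 A ≋ designGram v k λ' → A₁ ≋ designGram v k₁ λ₁ → A₂ ≋ designGram v k₂ λ₂ →
                 N ≋ ((λ' -ℤ λ₁ -ℤ λ₂) • (J v ⊖ I v))
  cross-term-≋ {A} {A₁} {A₂} {N} {k₁ = k₁} {k₂} {λ'} {λ₁} {λ₂} refl A-split A-gram A₁-gram A₂-gram i j = begin
    N i j                                         ≡⟨ solve 3 (λ a₁ n a₂ → n := a₁ :+ n :+ a₂ :- a₁ :- a₂) refl (A₁ i j) (N i j) (A₂ i j) ⟩
    A₁ i j +ℤ N i j +ℤ A₂ i j -ℤ A₁ i j -ℤ A₂ i j  ≡⟨ cong (λ x → x -ℤ A₁ i j -ℤ A₂ i j) (A-split i j) ⟨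
    A i j -ℤ A₁ i j -ℤ A₂ i j                      ≡⟨ cong₂ _-ℤ_ (cong₂ _-ℤ_ (A-gram i j) (A₁-gram i j)) (A₂-gram i j) ⟩
    designGram v (k₁ +ℤ k₂) λ' i j -ℤ designGram v k₁ λ₁ i j -ℤ designGram v k₂ λ₂ i j
      ≡⟨ solve 6 (λ a₁ a₂ l l₁ l₂ δ →
                   ((a₁ :+ a₂) :- l) :* δ :+ l :* con 1ℤ
                     :- ((a₁ :- l₁) :* δ :+ l₁ :* con 1ℤ) :- ((a₂ :- l₂) :* δ :+ l₂ :* con 1ℤ)
                   := (l :- l₁ :- l₂) :* (con 1ℤ :- δ))
               refl k₁ k₂ λ' λ₁ λ₂ (I v i j) ⟩
    (λ' -ℤ λ₁ -ℤ λ₂) *ℤ (1ℤ -ℤ I v i j)              ∎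

rowSum-•-J⊖I : ∀ n c → rowSum (c • (J (suc n) ⊖ I (suc n))) zero ≡ c *ℤ + n
rowSum-•-J⊖I n c = begin
  c *ℤ (1ℤ -ℤ 1ℤ) +ℤ sumFin {n} (λ _ → c *ℤ (1ℤ -ℤ 0ℤ))  ≡⟨ cong (c *ℤ (1ℤ -ℤ 1ℤ) +ℤ_) (sumFin-const n _) ⟩
  c *ℤ (1ℤ -ℤ 1ℤ) +ℤ + n *ℤ (c *ℤ (1ℤ -ℤ 0ℤ))          ≡⟨ solve 2 (λ c n → c :* (con 1ℤ :- con 1ℤ) :+ n :* (c :* (con 1ℤ :- con 0ℤ)) := c :* n) refl c (+ n) ⟩
  c *ℤ + n                                           ∎

pos-2*m*n : ∀ m n → + (2 * m * n) ≡ + m *ℤ + n +ℤ + n *ℤ + m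
pos-2*m*n m n = begin
  + (2 * m * n)         ≡⟨ ℤP.pos-* (2 * m) n ⟩
  + (2 * m) *ℤ + n      ≡⟨ cong (_*ℤ + n) (ℤP.pos-* 2 m) ⟩
  + 2 *ℤ + m *ℤ + n     ≡⟨ solve 2 (λ a b → con (+ 2) :* a :* b := a :* b :+ b :* a) refl (+ m) (+ n) ⟩
  + m *ℤ + n +ℤ + n *ℤ + m ∎

proposition4p8 : (v k λ' k₁ λ₁ k₂ λ₂ : ℕ) → v ≥ 2 → (M M₁ M₂ : Matrix v)
    → IsSymmetricDesign v k λ' M
    → IsSymmetricDesign v k₁ λ₁ M₁
    → IsSymmetricDesign v k₂ λ₂ M₂
    → M ≋ (M₁ ⊕ M₂)
    → (k ≡ k₁ + k₂)
      × (∃[ α ] ((α *ℤ (+ (v ∸ 1)) ≡ + (2 * k₁ * k₂))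
                × ((+ λ') ≡ (+ λ₁) +ℤ (+ λ₂) +ℤ α)
                × (((M₁ · (M₂ ᵀ)) ⊕ (M₂ · (M₁ ᵀ))) ≋ (α • (J v ⊖ I v)))))
proposition4p8 .(suc (suc n)) k λ' k₁ λ₁ k₂ λ₂ (s≤s (s≤s {n = n} _)) M M₁ M₂ D D₁ D₂ M≋M₁⊕M₂ =
  ℤP.+-injective (trans k≡k₁+k₂ (sym (ℤP.pos-+ k₁ k₂))) , α , α*[v-1]≡2k₁k₂ , λ'≡λ₁+λ₂+α , N≋α[J-I]
  where
  module D = IsSymmetricDesign D
  module D₁ = IsSymmetricDesign D₁
  module D₂ = IsSymmetricDesign D₂

  N : Matrix (suc (suc n))
  N = (M₁ · (M₂ ᵀ)) ⊕ (M₂ · (M₁ ᵀ))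

  α : ℤ
  α = + λ' -ℤ + λ₁ -ℤ + λ₂

  λ'≡λ₁+λ₂+α : + λ' ≡ + λ₁ +ℤ + λ₂ +ℤ α
  λ'≡λ₁+λ₂+α = solve 3 (λ l l₁ l₂ → l := l₁ :+ l₂ :+ (l :- l₁ :- l₂)) refl (+ λ') (+ λ₁) (+ λ₂)

  k≡k₁+k₂ : + k ≡ + k₁ +ℤ + k₂
  k≡k₁+k₂ = begin
    + k                                ≡⟨ D.rowSums zero ⟨
    rowSum M zero                      ≡⟨ sumFin-cong (M≋M₁⊕M₂ zero) ⟩
    rowSum (M₁ ⊕ M₂) zero              ≡⟨ sumFin-distrib-+ (M₁ zero) (M₂ zero) ⟩
    rowSum M₁ zero +ℤ rowSum M₂ zero   ≡⟨ cong₂ _+ℤ_ (D₁.rowSums zero) (D₂.rowSums zero) ⟩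
    + k₁ +ℤ + k₂                       ∎

  MMᵀ-split : (M · (M ᵀ)) ≋ (((M₁ · (M₁ ᵀ)) ⊕ N) ⊕ (M₂ · (M₂ ᵀ)))
  MMᵀ-split i j = trans (·-cong M≋M₁⊕M₂ (λ i j → M≋M₁⊕M₂ j i) i j) (⊕-·-⊕ᵀ M₁ M₂ i j)

  N≋α[J-I] : N ≋ (α • (J (suc (suc n)) ⊖ I (suc (suc n))))
  N≋α[J-I] = cross-term-≋ {k₁ = + k₁} {+ k₂} {+ λ'} {+ λ₁} {+ λ₂} k≡k₁+k₂ MMᵀ-split D.MMᵀ D₁.MMᵀ D₂.MMᵀ

  α*[v-1]≡2k₁k₂ : α *ℤ + suc n ≡ + (2 * k₁ * k₂)
  α*[v-1]≡2k₁k₂ = begin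
    α *ℤ + suc n                                           ≡⟨ rowSum-•-J⊖I (suc n) α ⟨
    rowSum (α • (J (suc (suc n)) ⊖ I (suc (suc n)))) zero  ≡⟨ sumFin-cong (N≋α[J-I] zero) ⟨
    rowSum N zero                                          ≡⟨ sumFin-distrib-+ ((M₁ · (M₂ ᵀ)) zero) ((M₂ · (M₁ ᵀ)) zero) ⟩
    rowSum (M₁ · (M₂ ᵀ)) zero +ℤ rowSum (M₂ · (M₁ ᵀ)) zero  ≡⟨ cong₂ _+ℤ_ (rowSum-·ᵀ M₁ M₂ zero (D₁.rowSums zero) D₂.colSums)
                                                                        (rowSum-·ᵀ M₂ M₁ zero (D₂.rowSums zero) D₁.colSums) ⟩
    + k₁ *ℤ + k₂ +ℤ + k₂ *ℤ + k₁                           ≡⟨ pos-2*m*n k₁ k₂ ⟨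
    + (2 * k₁ * k₂)                                        ∎
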